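{- Let $G=(V,E)$ be a connected finite simple graph with at least one edge. When the Enter-Exit Greedy Algorithm (EEGA) run on $G$ finishes its exit loop (i.e., reaches its final step), the current set $S$ is a minimal vertex cover of $G$.
   Context: Notation: $n=|V|$; $N(x)$ is the neighbourhood of $x$, $d_x=|N(x)|$, and $d_x(A)=|N(x)\cap A|$ for $A\subseteq V$. A vertex cover is a set of vertices containing at least one endpoint of every edge; it is minimal if no proper subset is a vertex cover. The EEGA on input $G$ is: Phase 1. Order the vertices as $x_1,\dots,x_n$ with $d_{x_1}\ge\dots\ge d_{x_n}$; set $d_i=d_{x_i}$; let $L$ be the smallest positive integer with $d_1+\dots+d_L\ge |E|$. Phase 2. Set $S=\{x_1,\dots,x_L\}$. (Entry loop) While there is $x\in V\setminus S$ with $d_x(V\setminus S)>0$, take the first such $x$ in the ordering and move it from $V\setminus S$ into $S$. (Exit loop) Then, while there is $y\in S$ with $d_y(V\setminus S)=0$, take the last such $y$ in the ordering and move it from $S$ into $V\setminus S$. (Final step) If $d_x(S)=0$ for every $x\in S$, set $U=\min\{|S|,n-|S|\}$, otherwise $U=|S|$; if $G$ is bipartite with bipartition $V=A\cup B$, replace $U$ by $\min\{U,|A|,|B|\}$. Return $U$. -}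

module Defs where

open import Data.Nat using (ℕ; zero; suc; _+_; _*_; _≤_; _<_; _<ᵇ_)
open import Data.Bool using (Bool; true; false; _∧_)
open import Data.Fin using (Fin; toℕ) renaming (_<_ to _<ꟳ_; _≤_ to _≤ꟳ_)
open import Data.Fin.Subset using (Subset; _∈_; _∉_; _⊂_; ∁; _∩_; _∪_; ⁅_⁆; _-_; ∣_∣)
open import Data.Fin.Permutation using (Permutation′; _⟨$⟩ʳ_; _⟨$⟩ˡ_)
open import Data.Vec using (tabulate; sum)
open import Data.Product using (_×_; ∃; ∃-syntax)
open import Data.Sum using (_⊎_)
open import Relation.Binary.PropositionalEquality using (_≡_)
open import Relation.Nullary using (¬_)

record Graph (n : ℕ) : Set where
  field
    adj    : Fin n → Fin n → Bool
    sym    : ∀ x y → adj x y ≡ adj y x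
    irrefl : ∀ x → adj x x ≡ false
open Graph public

module _ {n : ℕ} (G : Graph n) where

  Adj : Fin n → Fin n → Set
  Adj x y = adj G x y ≡ true

  nbhd : Fin n → Subset n
  nbhd x = tabulate (adj G x)

  deg : Fin n → ℕ
  deg x = ∣ nbhd x ∣

  degIn : Fin n → Subset n → ℕ
  degIn x A = ∣ nbhd x ∩ A ∣

  numEdges : ℕ
  numEdges = sum (tabulate (λ x → ∣ tabulate (λ y → (toℕ x <ᵇ toℕ y) ∧ adj G x y) ∣))

  data Reachable : Fin n → Fin n → Set where
    here : ∀ {x} → Reachable x x
    step : ∀ {x y z} → Adj x y → Reachable y z → Reachable x z

  Connected : Set
  Connected = ∀ x y → Reachable x y

  HasEdge : Set
  HasEdge = ∃[ x ] ∃[ y ] Adj x y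

  IsVertexCover : Subset n → Set
  IsVertexCover S = ∀ x y → Adj x y → x ∈ S ⊎ y ∈ S

  IsMinimalVertexCover : Subset n → Set
  IsMinimalVertexCover S = IsVertexCover S × (∀ T → T ⊂ S → ¬ IsVertexCover T)

  module EEGA (π : Permutation′ n) where

    x_ : Fin n → Fin n
    x_ i = π ⟨$⟩ʳ i

    DegreeOrdered : Set
    DegreeOrdered = ∀ i j → i ≤ꟳ j → deg (x_ j) ≤ deg (x_ i)

    prefixDegSum : ℕ → ℕ
    prefixDegSum k = sum (tabulate (λ i → if′ (toℕ i <ᵇ k) (deg (x_ i))))
      where
        if′ : Bool → ℕ → ℕ
        if′ true  m = m
        if′ false _ = 0

    IsL : ℕ → Set
    IsL L = 1 ≤ L × numEdges ≤ prefixDegSum L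
          × (∀ k → 1 ≤ k → k < L → prefixDegSum k < numEdges)

    initialS : ℕ → Subset n
    initialS L = tabulate (λ v → toℕ (π ⟨$⟩ˡ v) <ᵇ L)

    EntryCand : Subset n → Fin n → Set
    EntryCand S v = v ∉ S × 0 < degIn v (∁ S)

    data EntryRun : Subset n → Subset n → Set where
      done : ∀ {S} → (∀ i → ¬ EntryCand S (x_ i)) → EntryRun S S
      move : ∀ {S S′} (i : Fin n) → EntryCand S (x_ i)
           → (∀ j → j <ꟳ i → ¬ EntryCand S (x_ j))
           → EntryRun (S ∪ ⁅ x_ i ⁆) S′ → EntryRun S S′

    ExitCand : Subset n → Fin n → Set
    ExitCand S v = v ∈ S × degIn v (∁ S) ≡ 0

    data ExitRun : Subset n → Subset n → Set where
      done : ∀ {S} → (∀ i → ¬ ExitCand S (x_ i)) → ExitRun S S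
      move : ∀ {S S′} (i : Fin n) → ExitCand S (x_ i)
           → (∀ j → i <ꟳ j → ¬ ExitCand S (x_ j))
           → ExitRun (S - x_ i) S′ → ExitRun S S′

-- The entry loop halts only when no vertex outside S has a neighbour outside S,
-- i.e. when every edge meets S. The exit loop removes only vertices all of whose
-- neighbours lie in S; the edges at such a vertex stay covered by their other end,
-- so S remains a cover. It halts when every vertex of S has a neighbour outside S,
-- and then no vertex can be dropped: the edge to that neighbour would lose its
-- cover.
module Submission where

open import Defs
open import Data.Nat using (ℕ; _<_; _≤_)
open import Data.Fin using (Fin; _≟_)
open import Data.Fin.Subset
  using (Subset; _∈_; _∉_; _⊆_; _⊂_; ∁; _∩_; ⁅_⁆; _-_; ∣_∣; ⊥; Nonempty)
open import Data.Fin.Subset.Properties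
  using ( _∈?_; nonempty?; Empty-unique; ∣⊥∣≡0; ∣⁅x⁆∣≡1; x∈⁅y⁆⇒x≡y; x≢y⇒x∉⁅y⁆
        ; p⊆q⇒∣p∣≤∣q∣; x∈p∩q⁺; x∈p∩q⁻; x∉p⇒x∈∁p; x∈∁p⇒x∉p; x∈p∧x∉q⇒x∈p─q )
open import Data.Fin.Permutation using (Permutation′; _⟨$⟩ˡ_; inverseʳ)
open import Data.Vec.Properties using (lookup∘tabulate; lookup⇒[]=; []=⇒lookup)
open import Data.Product using (_×_; _,_; ∃-syntax)
open import Data.Sum using (_⊎_; inj₁; inj₂; [_,_]′; swap)
open import Function using (_∘_)
open import Relation.Nullary using (¬_; yes; no; contradiction)
open import Relation.Binary.PropositionalEquality
  using (_≡_; _≢_; refl; trans; cong; subst) renaming (sym to ≡-sym)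

module _ {n : ℕ} {p : Subset n} where

  Nonempty⇒∣p∣>0 : Nonempty p → 0 < ∣ p ∣
  Nonempty⇒∣p∣>0 (x , x∈p) = subst (_≤ ∣ p ∣) (∣⁅x⁆∣≡1 x) (p⊆q⇒∣p∣≤∣q∣ ⁅x⁆⊆p)
    where
    ⁅x⁆⊆p : ⁅ x ⁆ ⊆ p
    ⁅x⁆⊆p y∈⁅x⁆ = subst (_∈ p) (≡-sym (x∈⁅y⁆⇒x≡y x y∈⁅x⁆)) x∈p

  ∣p∣≢0⇒Nonempty : ∣ p ∣ ≢ 0 → Nonempty p
  ∣p∣≢0⇒Nonempty ∣p∣≢0 with nonempty? p
  ... | yes ne = ne
  ... | no  em = contradiction (trans (cong ∣_∣ (Empty-unique em)) (∣⊥∣≡0 n)) ∣p∣≢0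

module _ {n : ℕ} (G : Graph n) where

  Adj-sym : ∀ {x y} → Adj G x y → Adj G y x
  Adj-sym {x} {y} a = trans (Graph.sym G y x) a

  Adj⇒≢ : ∀ {x y} → Adj G x y → x ≢ y
  Adj⇒≢ {x} a refl with trans (≡-sym a) (irrefl G x)
  ... | ()

  Adj⇒∈nbhd : ∀ {x y} → Adj G x y → y ∈ nbhd G x
  Adj⇒∈nbhd {x} {y} a = lookup⇒[]= y (nbhd G x) (trans (lookup∘tabulate (adj G x) y) a)

  ∈nbhd⇒Adj : ∀ {x y} → y ∈ nbhd G x → Adj G x y
  ∈nbhd⇒Adj {x} {y} y∈N = trans (≡-sym (lookup∘tabulate (adj G x) y)) ([]=⇒lookup y∈N)

  Adj∧∉⇒degIn∁>0 : ∀ {S v w} → Adj G v w → w ∉ S → 0 < degIn G v (∁ S)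
  Adj∧∉⇒degIn∁>0 a w∉S = Nonempty⇒∣p∣>0 (_ , x∈p∩q⁺ (Adj⇒∈nbhd a , x∉p⇒x∈∁p w∉S))

  degIn∁≢0⇒outsideNeighbour : ∀ {S v} → degIn G v (∁ S) ≢ 0 → ∃[ w ] Adj G v w × w ∉ S
  degIn∁≢0⇒outsideNeighbour {S} {v} d≢0 with ∣p∣≢0⇒Nonempty d≢0
  ... | w , w∈N∩∁S with x∈p∩q⁻ (nbhd G v) (∁ S) w∈N∩∁S
  ...   | w∈N , w∈∁S = w , ∈nbhd⇒Adj w∈N , x∈∁p⇒x∉p w∈∁S

  degIn∁≡0⇒neighbour∈ : ∀ {S v w} → degIn G v (∁ S) ≡ 0 → Adj G v w → w ∈ S
  degIn∁≡0⇒neighbour∈ {S} d≡0 a with _ ∈? S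
  ... | yes w∈S = w∈S
  ... | no  w∉S with subst (0 <_) d≡0 (Adj∧∉⇒degIn∁>0 a w∉S)
  ...   | ()

  noEdgeOutside⇒IsVertexCover : ∀ {S} → (∀ v → ¬ (v ∉ S × 0 < degIn G v (∁ S)))
                              → IsVertexCover G S
  noEdgeOutside⇒IsVertexCover {S} noEdge x y a with x ∈? S | y ∈? S
  ... | yes x∈S | _       = inj₁ x∈S
  ... | no  _   | yes y∈S = inj₂ y∈S
  ... | no  x∉S | no  y∉S = contradiction (x∉S , Adj∧∉⇒degIn∁>0 a y∉S) (noEdge x)

  IsVertexCover-remove : ∀ {S v} → IsVertexCover G S → degIn G v (∁ S) ≡ 0
                       → IsVertexCover G (S - v)
  IsVertexCover-remove {S} {v} cover d≡0 x y a =
    [ coveredBy x y a , swap ∘ coveredBy y x (Adj-sym a) ]′ (cover x y a)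
    where
    coveredBy : ∀ x y → Adj G x y → x ∈ S → x ∈ S - v ⊎ y ∈ S - v
    coveredBy x y a x∈S with x ≟ v
    ... | no  x≢v = inj₁ (x∈p∧x∉q⇒x∈p─q x∈S (x≢y⇒x∉⁅y⁆ x≢v))
    ... | yes refl = inj₂ (x∈p∧x∉q⇒x∈p─q (degIn∁≡0⇒neighbour∈ d≡0 a)
                                         (x≢y⇒x∉⁅y⁆ (λ y≡x → Adj⇒≢ a (≡-sym y≡x))))

  outsideNeighbours⇒IsMinimalVertexCover
    : ∀ {S} → IsVertexCover G S → (∀ v → v ∈ S → ∃[ w ] Adj G v w × w ∉ S)
    → IsMinimalVertexCover G S
  outsideNeighbours⇒IsMinimalVertexCover {S} cover outside = cover , minimal
    where
    minimal : ∀ T → T ⊂ S → ¬ IsVertexCover G T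
    minimal T (T⊆S , v , v∈S , v∉T) coverT with outside v v∈S
    ... | w , a , w∉S = [ v∉T , w∉S ∘ T⊆S ]′ (coverT v w a)

  module _ (π : Permutation′ n) where
    open EEGA G π

    ∀positions⇒∀vertices : ∀ {P : Fin n → Set} → (∀ i → P (x_ i)) → ∀ v → P v
    ∀positions⇒∀vertices {P} P∘x v = subst P (inverseʳ π) (P∘x (π ⟨$⟩ˡ v))

    EntryRun⇒IsVertexCover : ∀ {S S′} → EntryRun S S′ → IsVertexCover G S′
    EntryRun⇒IsVertexCover (done noCand)    = noEdgeOutside⇒IsVertexCover
                                                 (∀positions⇒∀vertices noCand)
    EntryRun⇒IsVertexCover (move _ _ _ run) = EntryRun⇒IsVertexCover run

    ExitRun⇒IsMinimalVertexCover : ∀ {S S′} → IsVertexCover G S → ExitRun S S′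
                                 → IsMinimalVertexCover G S′
    ExitRun⇒IsMinimalVertexCover cover (done noCand) =
      outsideNeighbours⇒IsMinimalVertexCover cover λ v v∈S →
        degIn∁≢0⇒outsideNeighbour λ d≡0 →
          ∀positions⇒∀vertices {λ v → ¬ ExitCand _ v} noCand v (v∈S , d≡0)
    ExitRun⇒IsMinimalVertexCover cover (move _ (_ , d≡0) _ run) =
      ExitRun⇒IsMinimalVertexCover (IsVertexCover-remove cover d≡0) run

proposition4p3 : ∀ {n} (G : Graph n) → Connected G → HasEdge G
    → (π : Permutation′ n) → EEGA.DegreeOrdered G π
    → (L : ℕ) → EEGA.IsL G π L
    → (S₁ S₂ : Subset n)
    → EEGA.EntryRun G π (EEGA.initialS G π L) S₁
    → EEGA.ExitRun G π S₁ S₂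
    → IsMinimalVertexCover G S₂
proposition4p3 G _ _ π _ _ _ _ _ entry exit =
  ExitRun⇒IsMinimalVertexCover G π (EntryRun⇒IsVertexCover G π entry) exit
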